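{- A nontrivial connected graph $G$ is self $2$-resolved if and only if it does not have true twin vertices (i.e., there are no two distinct vertices $u,v$ with $N_G[u]=N_G[v]$).
   Context: $d_G$ is the shortest-path distance, $N_G[v]$ the closed neighborhood of $v$, and $I[x,y]$ the set of vertices lying on some shortest $x$–$y$ path. A connected graph $G$ is self $k$-resolved if for every two distinct vertices $x,y$ there is $w$ with either $d_G(y,w)\ge k$ and $x\in I[y,w]$, or $d_G(x,w)\ge k$ and $y\in I[x,w]$. Nontrivial means at least two vertices. -}

module Defs where

open import Data.Nat using (ℕ; zero; suc; _+_; _≤_)
open import Data.Fin using (Fin)
open import Data.Product using (Σ; _×_; ∃; ∃-syntax)
open import Data.Sum using (_⊎_)
open import Relation.Binary.PropositionalEquality using (_≡_)
open import Relation.Nullary using (¬_; Dec)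
open import Level using (0ℓ)
open import Function.Bundles using (_⇔_)

record Graph (n : ℕ) : Set₁ where
  field
    Adj   : Fin n → Fin n → Set
    sym   : ∀ {x y} → Adj x y → Adj y x
    irrefl : ∀ {x} → ¬ Adj x x
    dec   : ∀ x y → Dec (Adj x y)

module _ {n : ℕ} (G : Graph n) where
  open Graph G

  data Walk : Fin n → Fin n → ℕ → Set where
    here : ∀ {x} → Walk x x 0
    step : ∀ {x y z ℓ} → Adj x y → Walk y z ℓ → Walk x z (suc ℓ)

  Connected : Set
  Connected = ∀ x y → ∃[ ℓ ] Walk x y ℓ

  Dist : Fin n → Fin n → ℕ → Set
  Dist x y k = Walk x y k × (∀ m → Walk x y m → k ≤ m)

  DistAtLeast : Fin n → Fin n → ℕ → Set
  DistAtLeast x y k = ∃[ d ] (Dist x y d × k ≤ d)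

  InInterval : Fin n → Fin n → Fin n → Set
  InInterval z x y = ∃[ a ] ∃[ b ] (Dist x z a × Dist z y b × Dist x y (a + b))

  SelfResolved : ℕ → Set
  SelfResolved k = ∀ x y → ¬ x ≡ y →
    ∃[ w ] ((DistAtLeast y w k × InInterval x y w)
           ⊎ (DistAtLeast x w k × InInterval y x w))

  ClosedNbhd : Fin n → Fin n → Set
  ClosedNbhd v z = z ≡ v ⊎ Adj v z

  TrueTwins : Fin n → Fin n → Set
  TrueTwins u v = ¬ u ≡ v × (∀ z → ClosedNbhd u z ⇔ ClosedNbhd v z)

  HasTrueTwins : Set
  HasTrueTwins = ∃[ u ] ∃[ v ] TrueTwins u v

-- If u and v are true twins, every shortest path leaving u can be rerouted to
-- leave from v instead, so d(v,w) ≤ d(u,w) for all w ≠ u; hence u lies on no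
-- shortest v–w path with d(v,w) ≥ 2, and symmetrically, so the pair {u,v} is
-- not 2-resolved. Conversely, a non-adjacent pair x,y is resolved by w = x,
-- and an adjacent pair that is not twins has a vertex z in, say, N[x] ∖ N[y];
-- then y – x – z is a shortest path of length 2, so w = z resolves the pair.
module Submission where

open import Defs
open import Data.Nat using (ℕ; zero; suc; _≤_; _<_; z≤n; s≤s)
open import Data.Nat.Properties using (≤-refl; ≤-trans; ≮⇒≥; m+n≮n; +-identityʳ; n≤1+n; anyUpTo?)
open import Data.Nat.Induction using (<-wellFounded)
open import Data.Fin using (Fin; _≟_)
open import Data.Fin.Properties using (any?; ¬∀⟶∃¬)
open import Data.Product using (_×_; ∃-syntax; _,_; proj₂; uncurry)
open import Data.Sum using (_⊎_; inj₁; inj₂)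
open import Data.Empty using (⊥-elim)
open import Function using (_∘_; const)
open import Function.Bundles using (_⇔_; mk⇔; Equivalence)
open import Induction.WellFounded using (Acc; acc)
open import Relation.Nullary using (¬_; Dec; yes; no)
open import Relation.Nullary.Decidable using (_×-dec_; _→-dec_; _⊎-dec_; map′)
open import Relation.Unary using (Pred; Decidable)
open import Relation.Binary.PropositionalEquality using (_≡_; _≢_; refl; sym; subst)

least-witness : ∀ {p} {P : Pred ℕ p} → Decidable P →
                ∀ {ℓ} → P ℓ → ∃[ k ] (P k × (∀ m → P m → k ≤ m))
least-witness {P = P} P? = search (<-wellFounded _)
  where
  search : ∀ {ℓ} → Acc _<_ ℓ → P ℓ → ∃[ k ] (P k × (∀ m → P m → k ≤ m))
  search {ℓ} (acc smaller) Pℓ with anyUpTo? P? ℓ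
  ... | yes (m , m<ℓ , Pm) = search (smaller m<ℓ) Pm
  ... | no none = ℓ , Pℓ , λ m Pm → ≮⇒≥ (λ m<ℓ → none (m , m<ℓ , Pm))

module _ {n : ℕ} (G : Graph n) where
  open Graph G renaming (sym to adj-sym)

  Dominates : Fin n → Fin n → Set
  Dominates v u = ∀ z → ClosedNbhd G u z → ClosedNbhd G v z

  walk? : ∀ ℓ x y → Dec (Walk G x y ℓ)
  walk? zero x y with x ≟ y
  ... | yes refl = yes here
  ... | no x≢y = no λ { here → x≢y refl }
  walk? (suc ℓ) x y with any? (λ z → dec x z ×-dec walk? ℓ z y)
  ... | yes (z , xz , zy) = yes (step xz zy)
  ... | no none = no λ { (step xz zy) → none (_ , xz , zy) }

  walk⇒dist : ∀ {x y ℓ} → Walk G x y ℓ → ∃[ d ] Dist G x y d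
  walk⇒dist {x} {y} = least-witness (λ ℓ → walk? ℓ x y)

  adj⇒dist1 : ∀ {x y} → Adj x y → Dist G x y 1
  adj⇒dist1 xy = step xy here , λ where
    .0 here     → ⊥-elim (irrefl xy)
    _ (step _ _) → s≤s z≤n

  nonadj⇒2≤length : ∀ {x y ℓ} → x ≢ y → ¬ Adj x y → Walk G x y ℓ → 2 ≤ ℓ
  nonadj⇒2≤length x≢y _   here                = ⊥-elim (x≢y refl)
  nonadj⇒2≤length _   ¬xy (step xy here)      = ⊥-elim (¬xy xy)
  nonadj⇒2≤length _   _   (step _ (step _ _)) = s≤s (s≤s z≤n)

  distAtLeast≤length : ∀ {x y k ℓ} → DistAtLeast G x y k → Walk G x y ℓ → k ≤ ℓ
  distAtLeast≤length (d , (_ , minimal) , k≤d) w = ≤-trans k≤d (minimal _ w)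

  closedNbhd⇒walk≤1 : ∀ {v z} → ClosedNbhd G v z → ∃[ ℓ ] (ℓ ≤ 1 × Walk G v z ℓ)
  closedNbhd⇒walk≤1 (inj₁ refl) = 0 , z≤n , here
  closedNbhd⇒walk≤1 (inj₂ vz)   = 1 , ≤-refl , step vz here

  dominates⇒shorter-walk : ∀ {u v w ℓ} → Dominates v u → w ≢ u →
                           Walk G u w ℓ → ∃[ m ] (m ≤ ℓ × Walk G v w m)
  dominates⇒shorter-walk _ w≢u here = ⊥-elim (w≢u refl)
  dominates⇒shorter-walk {ℓ = suc ℓ} v≽u _ (step ut tw) with v≽u _ (inj₂ ut)
  ... | inj₁ refl = ℓ , n≤1+n ℓ , tw
  ... | inj₂ vt   = suc ℓ , ≤-refl , step vt tw

  far⇒∉closedNbhd : ∀ {v w} → DistAtLeast G v w 2 → ¬ ClosedNbhd G v w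
  far⇒∉closedNbhd 2≤dvw vw with closedNbhd⇒walk≤1 vw
  ... | _ , ℓ≤1 , walk with ≤-trans (distAtLeast≤length 2≤dvw walk) ℓ≤1
  ...   | s≤s ()

  -- d(v,u) + d(u,w) = d(v,w) ≤ d(u,w) forces d(v,u) = 0.
  dominated-interval⇒≡ : ∀ {u v w} → Dominates v u → w ≢ u → InInterval G u v w → u ≡ v
  dominated-interval⇒≡ v≽u w≢u (a , b , (vu , _) , (uw , _) , (_ , minimal))
    with dominates⇒shorter-walk v≽u w≢u uw
  ... | m , m≤b , vw with a | vu | ≤-trans (minimal m vw) m≤b
  ...   | zero  | here | _     = refl
  ...   | suc a | _    | a+b<b = ⊥-elim (m+n≮n a b a+b<b)

  dominated-¬resolves : ∀ {u v w} → Dominates v u → u ≢ v →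
                        ¬ (DistAtLeast G v w 2 × InInterval G u v w)
  dominated-¬resolves {u} {w = w} v≽u u≢v (2≤dvw , u∈I) with w ≟ u
  ... | yes refl = far⇒∉closedNbhd 2≤dvw (v≽u u (inj₁ refl))
  ... | no w≢u   = u≢v (dominated-interval⇒≡ v≽u w≢u u∈I)

  selfResolved₂⇒¬trueTwins : SelfResolved G 2 → ¬ HasTrueTwins G
  selfResolved₂⇒¬trueTwins resolved (u , v , u≢v , twins) with resolved u v u≢v
  ... | _ , inj₁ resolves = dominated-¬resolves (Equivalence.to ∘ twins) u≢v resolves
  ... | _ , inj₂ resolves = dominated-¬resolves (Equivalence.from ∘ twins) (u≢v ∘ sym) resolves

  closedNbhd? : ∀ v z → Dec (ClosedNbhd G v z)
  closedNbhd? v z = (z ≟ v) ⊎-dec dec v z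

  ¬twins⇒distinguishing-vertex : ∀ {u v} → ¬ (∀ z → ClosedNbhd G u z ⇔ ClosedNbhd G v z) →
    ∃[ z ] ((ClosedNbhd G u z × ¬ ClosedNbhd G v z) ⊎ (ClosedNbhd G v z × ¬ ClosedNbhd G u z))
  ¬twins⇒distinguishing-vertex {u} {v} ¬same with ¬∀⟶∃¬ n _ agree? ¬same
    where
    agree? : ∀ z → Dec (ClosedNbhd G u z ⇔ ClosedNbhd G v z)
    agree? z = map′ (uncurry mk⇔) (λ u⇔v → Equivalence.to u⇔v , Equivalence.from u⇔v)
                    ((closedNbhd? u z →-dec closedNbhd? v z) ×-dec (closedNbhd? v z →-dec closedNbhd? u z))
  ... | z , disagree with closedNbhd? u z | closedNbhd? v z
  ...   | yes uz | yes vz = ⊥-elim (disagree (mk⇔ (const vz) (const uz)))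
  ...   | no ¬uz | no ¬vz = ⊥-elim (disagree (mk⇔ (⊥-elim ∘ ¬uz) (⊥-elim ∘ ¬vz)))
  ...   | yes uz | no ¬vz = z , inj₁ (uz , ¬vz)
  ...   | no ¬uz | yes vz = z , inj₂ (vz , ¬uz)

  nonadj-resolves : ∀ {x y d} → x ≢ y → ¬ Adj y x → Dist G y x d →
                    DistAtLeast G y x 2 × InInterval G x y x
  nonadj-resolves {d = d} x≢y ¬yx dyx@(yx , _) =
    (d , dyx , nonadj⇒2≤length (x≢y ∘ sym) ¬yx yx) ,
    (d , 0 , dyx , (here , λ _ _ → z≤n) , subst (Dist G _ _) (sym (+-identityʳ d)) dyx)

  private-neighbour-resolves : ∀ {x y z} → Adj y x → ClosedNbhd G x z → ¬ ClosedNbhd G y z →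
                               DistAtLeast G y z 2 × InInterval G x y z
  private-neighbour-resolves yx (inj₁ refl) ¬yz = ⊥-elim (¬yz (inj₂ yx))
  private-neighbour-resolves yx (inj₂ xz)   ¬yz =
    (2 , dyz , ≤-refl) , (1 , 1 , adj⇒dist1 yx , adj⇒dist1 xz , dyz)
    where
    dyz : Dist G _ _ 2
    dyz = step yx (step xz here) , λ _ → nonadj⇒2≤length (¬yz ∘ inj₁ ∘ sym) (¬yz ∘ inj₂)

  ¬trueTwins⇒selfResolved₂ : Connected G → ¬ HasTrueTwins G → SelfResolved G 2
  ¬trueTwins⇒selfResolved₂ connected noTwins x y x≢y with dec y x
  ... | no ¬yx = x , inj₁ (nonadj-resolves x≢y ¬yx (proj₂ (walk⇒dist (proj₂ (connected y x)))))
  ... | yes yx with ¬twins⇒distinguishing-vertex (λ same → noTwins (x , y , x≢y , same))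
  ...   | z , inj₁ (xz , ¬yz) = z , inj₁ (private-neighbour-resolves yx xz ¬yz)
  ...   | z , inj₂ (yz , ¬xz) = z , inj₂ (private-neighbour-resolves (adj-sym yx) yz ¬xz)

lemma1 : (n : ℕ) → 2 ≤ n → (G : Graph n) → Connected G →
    SelfResolved G 2 ⇔ (¬ HasTrueTwins G)
lemma1 _ _ G connected = mk⇔ (selfResolved₂⇒¬trueTwins G) (¬trueTwins⇒selfResolved₂ G connected)
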